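{- Let $t\ge 1$ and let $p_1,\dots,p_t$ be positive integers with $2p_1\leq p_2\leq p_3\leq\dots\leq p_t$. If $G=K_{2p_1}\,\square\,K_{p_2}\,\square\,K_{p_3}\,\square\,\cdots\,\square\,K_{p_t}$, then $BW(G)=p_1^2p_2\cdots p_t$.
   Context: $K_m$ is the complete graph on $m$ vertices. The Cartesian product $G\,\square\,H$ has vertex set $V(G)\times V(H)$, with $(g,h)$ adjacent to $(g',h')$ iff either $g=g'$ and $hh'\in E(H)$, or $h=h'$ and $gg'\in E(G)$. The bisection width $BW(G)$ is the minimum, over all partitions $V(G)=A\cup B$ with $\bigl||A|-|B|\bigr|\le 1$, of the number of edges between $A$ and $B$. -}

module Defs where

open import Data.Bool using (Bool; true; false; not; _∧_; _∨_; if_then_else_)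
open import Data.Nat using (ℕ; _≤_; _+_)
open import Data.Fin using (Fin)
import Data.Fin as Fin
open import Data.List using (List; []; _∷_; length; filter; cartesianProduct; allFin)
open import Data.Product using (_×_; _,_; proj₁; proj₂; ∃)
open import Relation.Binary.Definitions using (DecidableEquality)
open import Relation.Binary.PropositionalEquality using (_≡_)
open import Relation.Nullary.Decidable using (⌊_⌋)
open import Function using (_∘_)

-- A finite simple graph: a vertex type with an explicit duplicate-free
-- enumeration, decidable equality and a (symmetric, irreflexive) Boolean
-- adjacency relation.
record Graph : Set₁ where
  field
    V     : Set
    verts : List V
    _≟_   : DecidableEquality V
    adj   : V → V → Bool
open Graph public

K : ℕ → Graph
K m = record
  { V = Fin m
  ; verts = allFin m
  ; _≟_ = Fin._≟_
  ; adj = λ i j → not ⌊ i Fin.≟ j ⌋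
  }

_□_ : Graph → Graph → Graph
G □ H = record
  { V = V G × V H
  ; verts = cartesianProduct (verts G) (verts H)
  ; _≟_ = eq
  ; adj = λ { (g , h) (g' , h') →
        (⌊ (_≟_ G) g g' ⌋ ∧ adj H h h') ∨ (⌊ (_≟_ H) h h' ⌋ ∧ adj G g g') }
  }
  where
  open import Data.Product.Properties using (≡-dec)
  eq : DecidableEquality (V G × V H)
  eq = ≡-dec (_≟_ G) (_≟_ H)

boxKs : Graph → List ℕ → Graph
boxKs G [] = G
boxKs G (q ∷ qs) = boxKs (G □ K q) qs

-- a partition V = A ∪ B is given by the indicator A : V → Bool (B = complement)
sizeA : (G : Graph) → (V G → Bool) → ℕ
sizeA G A = length (filter (λ v → A v Data.Bool.≟ true) (verts G))

sizeB : (G : Graph) → (V G → Bool) → ℕ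
sizeB G A = length (filter (λ v → A v Data.Bool.≟ false) (verts G))

Balanced : (G : Graph) → (V G → Bool) → Set
Balanced G A = (sizeA G A ≤ sizeB G A + 1) × (sizeB G A ≤ sizeA G A + 1)

-- number of edges between A and B: ordered pairs (u , v) with u ∈ A, v ∈ B,
-- u adjacent to v (each such edge counted exactly once)
cut : (G : Graph) → (V G → Bool) → ℕ
cut G A = length (filter (λ uv → (A (proj₁ uv) ∧ not (A (proj₂ uv)) ∧ adj G (proj₁ uv) (proj₂ uv)) Data.Bool.≟ true)
                         (cartesianProduct (verts G) (verts G)))

BWis : Graph → ℕ → Set
BWis G k = (∃ λ (A : V G → Bool) → Balanced G A × cut G A ≡ k)
         × ((A : V G → Bool) → Balanced G A → k ≤ cut G A)

-- K_n routes every ordered pair (u , v) along the edge uv, and G □ H routes the pair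
-- ((g , h) , (g' , h')) through (g' , h): first inside the copy of G at h, then inside the
-- copy of H at g'. Since 2p₁ ≤ p₂ ≤ ⋯ ≤ p_t, this yields a routing of all ordered pairs of
-- K_{2p₁} □ K_{p₂} □ ⋯ □ K_{p_t} in which every edge carries at most P = p₂⋯p_t paths, so
-- |A| |B| ≤ P · cut(A) for every partition. A balanced partition has |A| = |B| = p₁ P,
-- whence cut(A) ≥ p₁² P; the partition {i < p₁} × K_{p₂} × ⋯ × K_{p_t} attains this.
module Submission where

open import Defs
open import Data.Bool as Bool using (Bool; true; false; not; _∧_; _∨_)
open import Data.Bool.Properties using (∨-identityʳ)
open import Data.Nat using (ℕ; zero; suc; _+_; _*_; _≤_; _<ᵇ_; _⊓_; z≤n; s≤s; NonZero; >-nonZero)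
open import Data.Nat.Properties hiding (_≟_)
open import Data.Nat.ListAction using (product)
open import Data.Nat.ListAction.Properties using (product≢0)
open import Data.Nat.Tactic.RingSolver using (solve-∀)
open import Algebra.Properties.CommutativeSemigroup +-commutativeSemigroup using (interchange)
open import Data.Fin using (Fin; toℕ)
import Data.Fin as Fin
open import Data.List using (List; []; _∷_; _++_; length; map; filter; cartesianProduct; allFin)
open import Data.List.Properties using (length-tabulate; map-tabulate)
open import Data.List.Membership.Propositional using (_∈_)
open import Data.List.Relation.Unary.Any using (here; there)
open import Data.List.Relation.Unary.All as All using (All; []; _∷_)
open import Data.List.Relation.Unary.Linked using (Linked)
open import Data.List.Relation.Unary.Linked.Properties using (Linked⇒AllPairs)
import Data.List.Relation.Unary.AllPairs as AllPairs
open import Data.Product using (_×_; _,_; proj₁)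
open import Data.Empty using (⊥-elim)
open import Relation.Binary.Definitions using (DecidableEquality)
open import Relation.Binary.PropositionalEquality
open import Relation.Nullary.Decidable using (⌊_⌋; yes; no)
open import Function using (_∘_)

⟦_⟧ : Bool → ℕ
⟦ true ⟧ = 1
⟦ false ⟧ = 0

∑ : {X : Set} → List X → (X → ℕ) → ℕ
∑ [] f = 0
∑ (x ∷ xs) f = f x + ∑ xs f

syntax ∑ xs (λ x → e) = ∑[ x ∈ xs ] e

module _ {X : Set} where

  ∑-cong : (xs : List X) {f g : X → ℕ} → (∀ x → f x ≡ g x) → ∑ xs f ≡ ∑ xs g
  ∑-cong [] f≡g = refl
  ∑-cong (x ∷ xs) f≡g = cong₂ _+_ (f≡g x) (∑-cong xs f≡g)

  ∑-mono-∈ : (xs : List X) {f g : X → ℕ} → (∀ {x} → x ∈ xs → f x ≤ g x) → ∑ xs f ≤ ∑ xs g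
  ∑-mono-∈ [] f≤g = z≤n
  ∑-mono-∈ (x ∷ xs) f≤g = +-mono-≤ (f≤g (here refl)) (∑-mono-∈ xs (f≤g ∘ there))

  ∑-mono : (xs : List X) {f g : X → ℕ} → (∀ x → f x ≤ g x) → ∑ xs f ≤ ∑ xs g
  ∑-mono xs f≤g = ∑-mono-∈ xs (λ {x} _ → f≤g x)

  ∑-++ : (xs ys : List X) (f : X → ℕ) → ∑ (xs ++ ys) f ≡ ∑ xs f + ∑ ys f
  ∑-++ [] ys f = refl
  ∑-++ (x ∷ xs) ys f = trans (cong (f x +_) (∑-++ xs ys f)) (sym (+-assoc (f x) _ _))

  ∑-distrib-+ : (xs : List X) (f g : X → ℕ) → ∑[ x ∈ xs ] (f x + g x) ≡ ∑ xs f + ∑ xs g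
  ∑-distrib-+ [] f g = refl
  ∑-distrib-+ (x ∷ xs) f g = trans (cong (f x + g x +_) (∑-distrib-+ xs f g)) (interchange (f x) (g x) _ _)

  ∑-*ˡ : (xs : List X) (c : ℕ) (f : X → ℕ) → ∑[ x ∈ xs ] (c * f x) ≡ c * ∑ xs f
  ∑-*ˡ [] c f = sym (*-zeroʳ c)
  ∑-*ˡ (x ∷ xs) c f = trans (cong (c * f x +_) (∑-*ˡ xs c f)) (sym (*-distribˡ-+ c (f x) _))

  ∑-*ʳ : (xs : List X) (f : X → ℕ) (c : ℕ) → ∑[ x ∈ xs ] (f x * c) ≡ ∑ xs f * c
  ∑-*ʳ xs f c = trans (∑-cong xs (λ x → *-comm (f x) c)) (trans (∑-*ˡ xs c f) (*-comm c _))

  ∑-const : (xs : List X) (c : ℕ) → ∑[ _ ∈ xs ] c ≡ c * length xs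
  ∑-const [] c = sym (*-zeroʳ c)
  ∑-const (x ∷ xs) c = trans (cong (c +_) (∑-const xs c)) (sym (*-suc c (length xs)))

  ∑-map : {Y : Set} (g : Y → X) (ys : List Y) (f : X → ℕ) → ∑ (map g ys) f ≡ ∑ ys (f ∘ g)
  ∑-map g [] f = refl
  ∑-map g (y ∷ ys) f = cong (f (g y) +_) (∑-map g ys f)

  ∑-⟦⟧+⟦not⟧ : (xs : List X) (f : X → Bool) →
    ∑[ x ∈ xs ] ⟦ f x ⟧ + ∑[ x ∈ xs ] ⟦ not (f x) ⟧ ≡ length xs
  ∑-⟦⟧+⟦not⟧ [] f = refl
  ∑-⟦⟧+⟦not⟧ (x ∷ xs) f with f x
  ... | true = cong suc (∑-⟦⟧+⟦not⟧ xs f)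
  ... | false = trans (+-suc _ _) (cong suc (∑-⟦⟧+⟦not⟧ xs f))

  length-filter-≟true : (xs : List X) (f : X → Bool) →
    length (filter (λ x → f x Bool.≟ true) xs) ≡ ∑[ x ∈ xs ] ⟦ f x ⟧
  length-filter-≟true [] f = refl
  length-filter-≟true (x ∷ xs) f with f x
  ... | true = cong suc (length-filter-≟true xs f)
  ... | false = length-filter-≟true xs f

  length-filter-≟false : (xs : List X) (f : X → Bool) →
    length (filter (λ x → f x Bool.≟ false) xs) ≡ ∑[ x ∈ xs ] ⟦ not (f x) ⟧
  length-filter-≟false [] f = refl
  length-filter-≟false (x ∷ xs) f with f x
  ... | true = length-filter-≟false xs f
  ... | false = cong suc (length-filter-≟false xs f)

  ∑-δ-≥ : (eq : DecidableEquality X) (xs : List X) {x : X} → x ∈ xs →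
    ∀ c → c ≤ ∑[ y ∈ xs ] (⟦ ⌊ eq x y ⌋ ⟧ * c)
  ∑-δ-≥ eq (y ∷ xs) {x} (here refl) c with eq x x
  ... | yes _ = ≤-trans (m≤m+n c 0) (m≤m+n _ _)
  ... | no x≢x = ⊥-elim (x≢x refl)
  ∑-δ-≥ eq (y ∷ xs) (there x∈xs) c = ≤-trans (∑-δ-≥ eq xs x∈xs c) (m≤n+m _ _)

module _ {X Y : Set} where

  ∑-cartesianProduct : (xs : List X) (ys : List Y) (f : X × Y → ℕ) →
    ∑ (cartesianProduct xs ys) f ≡ ∑[ x ∈ xs ] ∑[ y ∈ ys ] f (x , y)
  ∑-cartesianProduct [] ys f = refl
  ∑-cartesianProduct (x ∷ xs) ys f =
    trans (∑-++ (map (x ,_) ys) _ f) (cong₂ _+_ (∑-map (x ,_) ys f) (∑-cartesianProduct xs ys f))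

  ∑-comm : (xs : List X) (ys : List Y) (f : X → Y → ℕ) →
    ∑[ x ∈ xs ] ∑[ y ∈ ys ] f x y ≡ ∑[ y ∈ ys ] ∑[ x ∈ xs ] f x y
  ∑-comm [] ys f = sym (trans (∑-const ys 0) (*-zeroˡ (length ys)))
  ∑-comm (x ∷ xs) ys f = trans (cong (∑ ys (f x) +_) (∑-comm xs ys f)) (sym (∑-distrib-+ ys (f x) _))

  length-cartesianProduct : (xs : List X) (ys : List Y) → length (cartesianProduct xs ys) ≡ length xs * length ys
  length-cartesianProduct xs ys = begin
    length (cartesianProduct xs ys)        ≡⟨ sym (trans (∑-const (cartesianProduct xs ys) 1) (*-identityˡ _)) ⟩
    ∑[ _ ∈ cartesianProduct xs ys ] 1     ≡⟨ ∑-cartesianProduct xs ys (λ _ → 1) ⟩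
    ∑[ _ ∈ xs ] ∑[ _ ∈ ys ] 1             ≡⟨ ∑-cong xs (λ _ → trans (∑-const ys 1) (*-identityˡ _)) ⟩
    ∑[ _ ∈ xs ] length ys                 ≡⟨ trans (∑-const xs (length ys)) (*-comm (length ys) _) ⟩
    length xs * length ys                 ∎
    where open ≡-Reasoning

∑-allFin-suc : ∀ n (f : Fin (suc n) → ℕ) → ∑ (allFin (suc n)) f ≡ f Fin.zero + ∑[ i ∈ allFin n ] f (Fin.suc i)
∑-allFin-suc n f =
  cong (f Fin.zero +_) (trans (cong (λ is → ∑ is f) (sym (map-tabulate (λ i → i) Fin.suc))) (∑-map Fin.suc (allFin n) f))

⌊suc≟suc⌋ : ∀ {n} (i j : Fin n) → ⌊ Fin.suc i Fin.≟ Fin.suc j ⌋ ≡ ⌊ i Fin.≟ j ⌋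
⌊suc≟suc⌋ i j with i Fin.≟ j
... | yes _ = refl
... | no _ = refl

∑-δ-allFin : ∀ n (i : Fin n) → ∑[ j ∈ allFin n ] ⟦ ⌊ i Fin.≟ j ⌋ ⟧ ≡ 1
∑-δ-allFin (suc n) Fin.zero =
  trans (∑-allFin-suc n (λ j → ⟦ ⌊ Fin.zero Fin.≟ j ⌋ ⟧))
        (cong suc (trans (∑-const (allFin n) 0) (*-zeroˡ (length (allFin n)))))
∑-δ-allFin (suc n) (Fin.suc i) =
  trans (∑-allFin-suc n (λ j → ⟦ ⌊ Fin.suc i Fin.≟ j ⌋ ⟧))
        (trans (∑-cong (allFin n) (λ j → cong ⟦_⟧ (⌊suc≟suc⌋ i j))) (∑-δ-allFin n i))

∑-<ᵇ-allFin : ∀ n p → ∑[ i ∈ allFin n ] ⟦ toℕ i <ᵇ p ⟧ ≡ n ⊓ p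
∑-<ᵇ-allFin zero p = refl
∑-<ᵇ-allFin (suc n) zero =
  trans (∑-allFin-suc n (λ i → ⟦ toℕ i <ᵇ 0 ⟧)) (trans (∑-const (allFin n) 0) (*-zeroˡ (length (allFin n))))
∑-<ᵇ-allFin (suc n) (suc p) =
  trans (∑-allFin-suc n (λ i → ⟦ toℕ i <ᵇ suc p ⟧)) (cong suc (∑-<ᵇ-allFin n p))

sizeIn : (G : Graph) → (V G → Bool) → ℕ
sizeIn G A = ∑[ v ∈ verts G ] ⟦ A v ⟧

crossPairs : (G : Graph) → (V G → Bool) → ℕ
crossPairs G A = ∑[ u ∈ verts G ] ∑[ v ∈ verts G ] ⟦ A u ∧ not (A v) ⟧

crossEdges : (G : Graph) → (V G → Bool) → ℕ
crossEdges G A = ∑[ u ∈ verts G ] ∑[ v ∈ verts G ] ⟦ A u ∧ not (A v) ∧ adj G u v ⟧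

module _ (G : Graph) (A : V G → Bool) where

  sizeA≡sizeIn : sizeA G A ≡ sizeIn G A
  sizeA≡sizeIn = length-filter-≟true (verts G) A

  sizeB≡sizeIn-not : sizeB G A ≡ sizeIn G (not ∘ A)
  sizeB≡sizeIn-not = length-filter-≟false (verts G) A

  sizeIn+sizeIn-not : sizeIn G A + sizeIn G (not ∘ A) ≡ length (verts G)
  sizeIn+sizeIn-not = ∑-⟦⟧+⟦not⟧ (verts G) A

  cut≡crossEdges : cut G A ≡ crossEdges G A
  cut≡crossEdges = trans (length-filter-≟true (cartesianProduct (verts G) (verts G)) _)
                         (∑-cartesianProduct (verts G) (verts G) _)

  crossPairs≡sizeIn*sizeIn-not : crossPairs G A ≡ sizeIn G A * sizeIn G (not ∘ A)
  crossPairs≡sizeIn*sizeIn-not = begin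
    ∑[ u ∈ vs ] ∑[ v ∈ vs ] ⟦ A u ∧ not (A v) ⟧          ≡⟨ ∑-cong vs (λ u → ∑-cong vs λ v → ⟦⟧-∧ (A u) _) ⟩
    ∑[ u ∈ vs ] ∑[ v ∈ vs ] (⟦ A u ⟧ * ⟦ not (A v) ⟧)    ≡⟨ ∑-cong vs (λ u → ∑-*ˡ vs ⟦ A u ⟧ _) ⟩
    ∑[ u ∈ vs ] (⟦ A u ⟧ * sizeIn G (not ∘ A))            ≡⟨ ∑-*ʳ vs _ _ ⟩
    sizeIn G A * sizeIn G (not ∘ A)                       ∎
    where
    open ≡-Reasoning
    vs = verts G
    ⟦⟧-∧ : ∀ a b → ⟦ a ∧ b ⟧ ≡ ⟦ a ⟧ * ⟦ b ⟧
    ⟦⟧-∧ true b = sym (+-identityʳ _)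
    ⟦⟧-∧ false b = refl

-- Implied by a routing of all ordered vertex pairs in which every edge carries at most c paths.
Congestion : Graph → ℕ → Set
Congestion G c = ∀ A → crossPairs G A ≤ c * crossEdges G A

half-≤ : ∀ {a b M} → a + b ≡ M + M → a ≤ b + 1 → a ≤ M
half-≤ {a} {b} {M} a+b≡M+M a≤b+1 = ≮⇒≥ λ M<a → 1+n≰n (begin
    suc (suc (M + M))   ≡⟨ cong suc (sym (+-suc M M)) ⟩
    suc M + suc M       ≤⟨ +-mono-≤ M<a M<a ⟩
    a + a               ≤⟨ +-monoʳ-≤ a a≤b+1 ⟩
    a + (b + 1)         ≡⟨ sym (+-assoc a b 1) ⟩
    a + b + 1           ≡⟨ cong (_+ 1) a+b≡M+M ⟩
    M + M + 1           ≡⟨ +-comm (M + M) 1 ⟩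
    suc (M + M)         ∎)
  where open ≤-Reasoning

balanced-half : ∀ {a b M} → a + b ≡ M + M → a ≤ b + 1 → b ≤ a + 1 → a ≡ M
balanced-half {a} {b} {M} a+b≡M+M a≤b+1 b≤a+1 = ≤-antisym (half-≤ a+b≡M+M a≤b+1) (+-cancelʳ-≤ M M a (begin
    M + M   ≡⟨ sym a+b≡M+M ⟩
    a + b   ≤⟨ +-monoʳ-≤ a (half-≤ (trans (+-comm b a) a+b≡M+M) b≤a+1) ⟩
    a + M   ∎))
  where open ≤-Reasoning

congestion⇒bisection-≥ : ∀ G {c M} → Congestion G c → length (verts G) ≡ M + M →
  ∀ A → Balanced G A → M * M ≤ c * cut G A
congestion⇒bisection-≥ G {c} {M} congestion |G|≡M+M A (a≤b+1 , b≤a+1) = begin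
    M * M                                  ≡⟨ sym (cong₂ _*_ |A|≡M |B|≡M) ⟩
    sizeIn G A * sizeIn G (not ∘ A)        ≡⟨ sym (crossPairs≡sizeIn*sizeIn-not G A) ⟩
    crossPairs G A                         ≤⟨ congestion A ⟩
    c * crossEdges G A                     ≡⟨ cong (c *_) (sym (cut≡crossEdges G A)) ⟩
    c * cut G A                            ∎
  where
  open ≤-Reasoning
  |A|+|B|≡M+M : sizeIn G A + sizeIn G (not ∘ A) ≡ M + M
  |A|+|B|≡M+M = trans (sizeIn+sizeIn-not G A) |G|≡M+M
  |A|≡M : sizeIn G A ≡ M
  |A|≡M = balanced-half |A|+|B|≡M+M
    (subst₂ (λ x y → x ≤ y + 1) (sizeA≡sizeIn G A) (sizeB≡sizeIn-not G A) a≤b+1)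
    (subst₂ (λ x y → x ≤ y + 1) (sizeB≡sizeIn-not G A) (sizeA≡sizeIn G A) b≤a+1)
  |B|≡M : sizeIn G (not ∘ A) ≡ M
  |B|≡M = +-cancelˡ-≡ M _ _ (trans (cong (_+ sizeIn G (not ∘ A)) (sym |A|≡M)) |A|+|B|≡M+M)

length-verts-K : ∀ n → length (verts (K n)) ≡ n
length-verts-K n = length-tabulate {n = n} (λ i → i)

crossEdges-K : ∀ n A → crossEdges (K n) A ≡ crossPairs (K n) A
crossEdges-K n A = ∑-cong (allFin n) λ u → ∑-cong (allFin n) λ v → edge≡pair u v
  where
  edge≡pair : ∀ u v → ⟦ A u ∧ not (A v) ∧ not ⌊ u Fin.≟ v ⌋ ⟧ ≡ ⟦ A u ∧ not (A v) ⟧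
  edge≡pair u v with u Fin.≟ v
  edge≡pair u v | yes refl with A u
  ... | true = refl
  ... | false = refl
  edge≡pair u v | no _ with A u | A v
  ... | true | true = refl
  ... | true | false = refl
  ... | false | _ = refl

congestion-K : ∀ n → Congestion (K n) 1
congestion-K n A = ≤-reflexive (trans (sym (crossEdges-K n A)) (sym (*-identityˡ _)))

module Grid {X Y : Set} (xs : List X) (ys : List Y) where

  ∑⁴ : (X → Y → X → Y → ℕ) → ℕ
  ∑⁴ F = ∑[ g ∈ xs ] ∑[ h ∈ ys ] ∑[ g' ∈ xs ] ∑[ h' ∈ ys ] F g h g' h'

  ∑⁴-distrib-+ : ∀ F F' → ∑⁴ (λ g h g' h' → F g h g' h' + F' g h g' h') ≡ ∑⁴ F + ∑⁴ F'
  ∑⁴-distrib-+ F F' =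
    trans (∑-cong xs λ g → trans (∑-cong ys λ h → trans (∑-cong xs λ g' → ∑-distrib-+ ys _ _)
      (∑-distrib-+ xs _ _)) (∑-distrib-+ ys _ _)) (∑-distrib-+ xs _ _)

  ∑⁴-mono : ∀ F F' → (∀ g h g' h' → F g h g' h' ≤ F' g h g' h') → ∑⁴ F ≤ ∑⁴ F'
  ∑⁴-mono F F' F≤F' = ∑-mono xs λ g → ∑-mono ys λ h → ∑-mono xs λ g' → ∑-mono ys λ h' → F≤F' g h g' h'

  ∑²-cartesianProduct : (F : X × Y → X × Y → ℕ) →
    ∑[ u ∈ cartesianProduct xs ys ] ∑[ v ∈ cartesianProduct xs ys ] F u v ≡ ∑⁴ (λ g h g' h' → F (g , h) (g' , h'))
  ∑²-cartesianProduct F =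
    trans (∑-cartesianProduct xs ys _) (∑-cong xs λ g → ∑-cong ys λ h → ∑-cartesianProduct xs ys _)

module _ (G H : Graph) where
  open Grid (verts G) (verts H)

  crossEdges-□-≥ : (A : V G × V H → Bool) →
    ∑[ h ∈ verts H ] crossEdges G (λ g → A (g , h)) + ∑[ g ∈ verts G ] crossEdges H (λ h → A (g , h))
      ≤ crossEdges (G □ H) A
  crossEdges-□-≥ A = begin
      ∑[ h ∈ ys ] crossEdges G (λ g → A (g , h)) + ∑[ g ∈ xs ] crossEdges H (λ h → A (g , h))
    ≤⟨ +-mono-≤ rows≤ columns≤ ⟩
      ∑⁴ rowTerm + ∑⁴ columnTerm
    ≡⟨ sym (∑⁴-distrib-+ rowTerm columnTerm) ⟩
      ∑⁴ (λ g h g' h' → rowTerm g h g' h' + columnTerm g h g' h')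
    ≤⟨ ∑⁴-mono _ _ row+column≤edge ⟩
      ∑⁴ (λ g h g' h' → ⟦ A (g , h) ∧ not (A (g' , h')) ∧ adj (G □ H) (g , h) (g' , h') ⟧)
    ≡⟨ sym (∑²-cartesianProduct _) ⟩
      crossEdges (G □ H) A
    ∎
    where
    open ≤-Reasoning
    xs = verts G
    ys = verts H
    rowEdge : V G → V H → V G → ℕ
    rowEdge g h g' = ⟦ A (g , h) ∧ not (A (g' , h)) ∧ adj G g g' ⟧
    columnEdge : V G → V H → V H → ℕ
    columnEdge g h h' = ⟦ A (g , h) ∧ not (A (g , h')) ∧ adj H h h' ⟧

    rowTerm columnTerm : V G → V H → V G → V H → ℕ
    rowTerm g h g' h' = ⟦ ⌊ _≟_ H h h' ⌋ ⟧ * rowEdge g h g'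
    columnTerm g h g' h' = ⟦ ⌊ _≟_ G g g' ⌋ ⟧ * columnEdge g h h'

    rows≤ : ∑[ h ∈ ys ] crossEdges G (λ g → A (g , h)) ≤ ∑⁴ rowTerm
    rows≤ = begin
      ∑[ h ∈ ys ] ∑[ g ∈ xs ] ∑[ g' ∈ xs ] rowEdge g h g'   ≡⟨ sym (∑-comm xs ys _) ⟩
      ∑[ g ∈ xs ] ∑[ h ∈ ys ] ∑[ g' ∈ xs ] rowEdge g h g'   ≤⟨ ∑-mono xs (λ g → ∑-mono-∈ ys λ h∈ys →
                                                                 ∑-mono xs λ g' → ∑-δ-≥ (_≟_ H) ys h∈ys _) ⟩
      ∑⁴ rowTerm ∎

    columns≤ : ∑[ g ∈ xs ] crossEdges H (λ h → A (g , h)) ≤ ∑⁴ columnTerm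
    columns≤ = begin
      ∑[ g ∈ xs ] ∑[ h ∈ ys ] ∑[ h' ∈ ys ] columnEdge g h h'
        ≤⟨ ∑-mono-∈ xs (λ g∈xs → ∑-mono ys λ h → ∑-mono ys λ h' → ∑-δ-≥ (_≟_ G) xs g∈xs _) ⟩
      ∑[ g ∈ xs ] ∑[ h ∈ ys ] ∑[ h' ∈ ys ] ∑[ g' ∈ xs ] (⟦ ⌊ _≟_ G g g' ⌋ ⟧ * columnEdge g h h')
        ≡⟨ ∑-cong xs (λ g → ∑-cong ys λ h → ∑-comm ys xs _) ⟩
      ∑⁴ columnTerm ∎

    row+column≤edge : ∀ g h g' h' →
      ⟦ ⌊ _≟_ H h h' ⌋ ⟧ * rowEdge g h g' + ⟦ ⌊ _≟_ G g g' ⌋ ⟧ * columnEdge g h h'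
        ≤ ⟦ A (g , h) ∧ not (A (g' , h')) ∧
            ((⌊ _≟_ G g g' ⌋ ∧ adj H h h') ∨ (⌊ _≟_ H h h' ⌋ ∧ adj G g g')) ⟧
    row+column≤edge g h g' h' with _≟_ G g g' | _≟_ H h h'
    ... | yes refl | yes refl with A (g , h)
    ...   | true = z≤n
    ...   | false = z≤n
    row+column≤edge g h g' h' | yes refl | no _ =
      ≤-reflexive (trans (+-identityʳ _) (cong (λ e → ⟦ A (g , h) ∧ not (A (g , h')) ∧ e ⟧) (sym (∨-identityʳ _))))
    row+column≤edge g h g' h' | no _ | yes refl = ≤-reflexive (trans (+-identityʳ _) (+-identityʳ _))
    row+column≤edge g h g' h' | no _ | no _ = z≤n

  crossPairs-□-≤ : (A : V G × V H → Bool) →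
    crossPairs (G □ H) A ≤ length (verts H) * ∑[ h ∈ verts H ] crossPairs G (λ g → A (g , h))
                         + length (verts G) * ∑[ g ∈ verts G ] crossPairs H (λ h → A (g , h))
  crossPairs-□-≤ A = begin
      crossPairs (G □ H) A
    ≡⟨ ∑²-cartesianProduct _ ⟩
      ∑⁴ (λ g h g' h' → ⟦ A (g , h) ∧ not (A (g' , h')) ⟧)
    ≤⟨ ∑⁴-mono _ _ (λ g h g' h' → cross-≤-via (A (g , h)) (A (g' , h)) (A (g' , h'))) ⟩
      ∑⁴ (λ g h g' h' → rowPair g h g' + columnPair g' h h')
    ≡⟨ ∑⁴-distrib-+ _ _ ⟩
      ∑⁴ (λ g h g' h' → rowPair g h g') + ∑⁴ (λ g h g' h' → columnPair g' h h')
    ≡⟨ cong₂ _+_ rowPairs columnPairs ⟩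
      n * ∑[ h ∈ ys ] crossPairs G (λ g → A (g , h)) + m * ∑[ g ∈ xs ] crossPairs H (λ h → A (g , h))
    ∎
    where
    open ≤-Reasoning
    xs = verts G
    ys = verts H
    m = length xs
    n = length ys
    rowPair : V G → V H → V G → ℕ
    rowPair g h g' = ⟦ A (g , h) ∧ not (A (g' , h)) ⟧
    columnPair : V G → V H → V H → ℕ
    columnPair g' h h' = ⟦ A (g' , h) ∧ not (A (g' , h')) ⟧

    cross-≤-via : ∀ a b c → ⟦ a ∧ not c ⟧ ≤ ⟦ a ∧ not b ⟧ + ⟦ b ∧ not c ⟧
    cross-≤-via true true true = z≤n
    cross-≤-via true true false = s≤s z≤n
    cross-≤-via true false true = z≤n
    cross-≤-via true false false = s≤s z≤n
    cross-≤-via false b c = z≤n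

    rowPairs : ∑⁴ (λ g h g' h' → rowPair g h g') ≡ n * ∑[ h ∈ ys ] crossPairs G (λ g → A (g , h))
    rowPairs = begin-equality
      ∑[ g ∈ xs ] ∑[ h ∈ ys ] ∑[ g' ∈ xs ] ∑[ _ ∈ ys ] rowPair g h g'
        ≡⟨ ∑-cong xs (λ g → ∑-cong ys λ h → ∑-cong xs λ g' → trans (∑-const ys _) (*-comm _ n)) ⟩
      ∑[ g ∈ xs ] ∑[ h ∈ ys ] ∑[ g' ∈ xs ] (n * rowPair g h g')
        ≡⟨ ∑-cong xs (λ g → trans (∑-cong ys λ h → ∑-*ˡ xs n _) (∑-*ˡ ys n _)) ⟩
      ∑[ g ∈ xs ] (n * ∑[ h ∈ ys ] ∑[ g' ∈ xs ] rowPair g h g')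
        ≡⟨ trans (∑-*ˡ xs n _) (cong (n *_) (∑-comm xs ys _)) ⟩
      n * ∑[ h ∈ ys ] crossPairs G (λ g → A (g , h)) ∎

    columnPairs : ∑⁴ (λ g h g' h' → columnPair g' h h') ≡ m * ∑[ g ∈ xs ] crossPairs H (λ h → A (g , h))
    columnPairs = trans (∑-const xs _) (trans (*-comm _ m) (cong (m *_) (∑-comm ys xs _)))

  congestion-□ : ∀ {c d e} → Congestion G c → Congestion H d →
    length (verts H) * c ≤ e → length (verts G) * d ≤ e → Congestion (G □ H) e
  congestion-□ {c} {d} {e} congestionG congestionH nc≤e md≤e A = begin
      crossPairs (G □ H) A
    ≤⟨ crossPairs-□-≤ A ⟩
      n * ∑[ h ∈ ys ] crossPairs G (row h) + m * ∑[ g ∈ xs ] crossPairs H (column g)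
    ≤⟨ +-mono-≤ (*-monoʳ-≤ n (∑-mono ys λ h → congestionG (row h)))
                (*-monoʳ-≤ m (∑-mono xs λ g → congestionH (column g))) ⟩
      n * ∑[ h ∈ ys ] (c * crossEdges G (row h)) + m * ∑[ g ∈ xs ] (d * crossEdges H (column g))
    ≡⟨ cong₂ _+_ (trans (cong (n *_) (∑-*ˡ ys c _)) (sym (*-assoc n c _)))
                 (trans (cong (m *_) (∑-*ˡ xs d _)) (sym (*-assoc m d _))) ⟩
      n * c * ∑[ h ∈ ys ] crossEdges G (row h) + m * d * ∑[ g ∈ xs ] crossEdges H (column g)
    ≤⟨ +-mono-≤ (*-monoˡ-≤ _ nc≤e) (*-monoˡ-≤ _ md≤e) ⟩
      e * ∑[ h ∈ ys ] crossEdges G (row h) + e * ∑[ g ∈ xs ] crossEdges H (column g)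
    ≡⟨ sym (*-distribˡ-+ e _ _) ⟩
      e * (∑[ h ∈ ys ] crossEdges G (row h) + ∑[ g ∈ xs ] crossEdges H (column g))
    ≤⟨ *-monoʳ-≤ e (crossEdges-□-≥ A) ⟩
      e * crossEdges (G □ H) A
    ∎
    where
    open ≤-Reasoning
    xs = verts G
    ys = verts H
    m = length xs
    n = length ys
    row : V H → V G → Bool
    row h g = A (g , h)
    column : V G → V H → Bool
    column g h = A (g , h)

length-verts-□K : ∀ G q → length (verts (G □ K q)) ≡ length (verts G) * q
length-verts-□K G q = trans (length-cartesianProduct (verts G) (allFin q)) (cong (length (verts G) *_) (length-verts-K q))

length-verts-boxKs : ∀ G ps → length (verts (boxKs G ps)) ≡ length (verts G) * product ps
length-verts-boxKs G [] = sym (*-identityʳ _)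
length-verts-boxKs G (q ∷ qs) = begin
  length (verts (boxKs (G □ K q) qs))      ≡⟨ length-verts-boxKs (G □ K q) qs ⟩
  length (verts (G □ K q)) * product qs    ≡⟨ cong (_* product qs) (length-verts-□K G q) ⟩
  length (verts G) * q * product qs        ≡⟨ *-assoc (length (verts G)) q (product qs) ⟩
  length (verts G) * product (q ∷ qs)      ∎
  where open ≡-Reasoning

-- The invariant |V G| ≤ k c keeps the routing of G □ K q (q ≥ k) within congestion c q.
congestion-boxKs : ∀ {k c} G ps → All (k ≤_) ps → Congestion G c → length (verts G) ≤ k * c →
  Congestion (boxKs G ps) (c * product ps)
congestion-boxKs {c = c} G [] [] congestion _ = subst (Congestion G) (sym (*-identityʳ c)) congestion
congestion-boxKs {k} {c} G (q ∷ qs) (k≤q ∷ k≤qs) congestion |G|≤kc =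
  subst (Congestion (boxKs (G □ K q) qs)) (*-assoc c q (product qs))
    (congestion-boxKs (G □ K q) qs k≤qs
      (congestion-□ G (K q) congestion (congestion-K q) |K|c≤cq |G|≤cq)
      |G□K|≤kcq)
  where
  open ≤-Reasoning
  |K|c≤cq : length (verts (K q)) * c ≤ c * q
  |K|c≤cq = ≤-reflexive (trans (cong (_* c) (length-verts-K q)) (*-comm q c))
  |G|≤cq : length (verts G) * 1 ≤ c * q
  |G|≤cq = begin
    length (verts G) * 1   ≡⟨ *-identityʳ _ ⟩
    length (verts G)       ≤⟨ |G|≤kc ⟩
    k * c                  ≤⟨ *-monoˡ-≤ c k≤q ⟩
    q * c                  ≡⟨ *-comm q c ⟩
    c * q                  ∎
  |G□K|≤kcq : length (verts (G □ K q)) ≤ k * (c * q)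
  |G□K|≤kcq = begin
    length (verts (G □ K q))   ≡⟨ length-verts-□K G q ⟩
    length (verts G) * q       ≤⟨ *-monoˡ-≤ q |G|≤kc ⟩
    k * c * q                  ≡⟨ *-assoc k c q ⟩
    k * (c * q)                ∎

extend : (G : Graph) (ps : List ℕ) → (V G → Bool) → V (boxKs G ps) → Bool
extend G [] A = A
extend G (q ∷ qs) A = extend (G □ K q) qs (A ∘ proj₁)

extend-scales : (Φ : (G : Graph) → (V G → Bool) → ℕ) →
  (∀ G q A → Φ (G □ K q) (A ∘ proj₁) ≡ Φ G A * q) →
  ∀ G ps A → Φ (boxKs G ps) (extend G ps A) ≡ Φ G A * product ps
extend-scales Φ Φ-□K G [] A = sym (*-identityʳ _)
extend-scales Φ Φ-□K G (q ∷ qs) A = begin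
  Φ (boxKs (G □ K q) qs) (extend (G □ K q) qs (A ∘ proj₁))
    ≡⟨ extend-scales Φ Φ-□K (G □ K q) qs (A ∘ proj₁) ⟩
  Φ (G □ K q) (A ∘ proj₁) * product qs                        ≡⟨ cong (_* product qs) (Φ-□K G q A) ⟩
  Φ G A * q * product qs                                      ≡⟨ *-assoc (Φ G A) q (product qs) ⟩
  Φ G A * product (q ∷ qs)                                    ∎
  where open ≡-Reasoning

module _ (G : Graph) (q : ℕ) where

  ∑-□K-proj₁ : (f : V G → ℕ) → ∑[ v ∈ verts (G □ K q) ] f (proj₁ v) ≡ ∑ (verts G) f * q
  ∑-□K-proj₁ f =
    trans (∑-cartesianProduct (verts G) (allFin q) _)
          (trans (∑-cong (verts G) (λ g → trans (∑-const (allFin q) (f g)) (cong (f g *_) (length-verts-K q))))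
                 (∑-*ʳ (verts G) f q))

  sizeIn-□K : (A : V G → Bool) → sizeIn (G □ K q) (A ∘ proj₁) ≡ sizeIn G A * q
  sizeIn-□K A = ∑-□K-proj₁ (⟦_⟧ ∘ A)

  crossEdges-□K : (A : V G → Bool) → crossEdges (G □ K q) (A ∘ proj₁) ≡ crossEdges G A * q
  crossEdges-□K A = begin
      crossEdges (G □ K q) (A ∘ proj₁)
    ≡⟨ ∑²-cartesianProduct _ ⟩
      ∑⁴ (λ g h g' h' → ⟦ A g ∧ not (A g') ∧ adj (G □ K q) (g , h) (g' , h') ⟧)
    ≡⟨ ∑-cong xs (λ g → ∑-cong ys λ h → ∑-cong xs λ g' → ∑-cong ys λ h' → edge≡ g h g' h') ⟩
      ∑⁴ (λ g h g' h' → edge g g' * ⟦ ⌊ h Fin.≟ h' ⌋ ⟧)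
    ≡⟨ ∑-cong xs (λ g → ∑-cong ys λ h → ∑-cong xs λ g' →
         trans (∑-*ˡ ys (edge g g') _) (trans (cong (edge g g' *_) (∑-δ-allFin q h)) (*-identityʳ _))) ⟩
      ∑[ g ∈ xs ] ∑[ _ ∈ ys ] ∑[ g' ∈ xs ] edge g g'
    ≡⟨ ∑-cong xs (λ g → trans (∑-const ys _) (cong (∑ xs (edge g) *_) (length-verts-K q))) ⟩
      ∑[ g ∈ xs ] (∑[ g' ∈ xs ] edge g g' * q)
    ≡⟨ ∑-*ʳ xs _ q ⟩
      crossEdges G A * q
    ∎
    where
    open ≡-Reasoning
    open Grid (verts G) (allFin q)
    xs = verts G
    ys = allFin q
    edge : V G → V G → ℕ
    edge g g' = ⟦ A g ∧ not (A g') ∧ adj G g g' ⟧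
    edge≡ : ∀ g h g' h' →
      ⟦ A g ∧ not (A g') ∧ ((⌊ _≟_ G g g' ⌋ ∧ not ⌊ h Fin.≟ h' ⌋) ∨ (⌊ h Fin.≟ h' ⌋ ∧ adj G g g')) ⟧
        ≡ edge g g' * ⟦ ⌊ h Fin.≟ h' ⌋ ⟧
    edge≡ g h g' h' with _≟_ G g g' | h Fin.≟ h'
    edge≡ g h g' h' | yes refl | _ with A g
    ... | true = refl
    ... | false = refl
    edge≡ g h g' h' | no _ | yes _ = sym (*-identityʳ _)
    edge≡ g h g' h' | no _ | no _ with A g | A g'
    ... | true | true = refl
    ... | true | false = sym (*-zeroʳ ⟦ adj G g g' ⟧)
    ... | false | _ = refl

equal-sizes⇒Balanced : ∀ G A → sizeA G A ≡ sizeB G A → Balanced G A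
equal-sizes⇒Balanced G A |A|≡|B| =
  ≤-trans (≤-reflexive |A|≡|B|) (m≤m+n _ 1) , ≤-trans (≤-reflexive (sym |A|≡|B|)) (m≤m+n _ 1)

extend-balanced-cut : ∀ G ps A {a e} → sizeIn G A ≡ a → sizeIn G (not ∘ A) ≡ a → crossEdges G A ≡ e →
  Balanced (boxKs G ps) (extend G ps A) × cut (boxKs G ps) (extend G ps A) ≡ e * product ps
extend-balanced-cut G ps A |A|≡a |B|≡a crossEdges≡e =
  equal-sizes⇒Balanced H A⁺ (trans |A⁺| (sym |B⁺|)) ,
  trans (cut≡crossEdges H A⁺) (trans (extend-scales crossEdges crossEdges-□K G ps A) (cong (_* product ps) crossEdges≡e))
  where
  H = boxKs G ps
  A⁺ = extend G ps A
  |A⁺| : sizeA H A⁺ ≡ sizeIn G A * product ps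
  |A⁺| = trans (sizeA≡sizeIn H A⁺) (extend-scales sizeIn sizeIn-□K G ps A)
  |B⁺| : sizeB H A⁺ ≡ sizeIn G A * product ps
  |B⁺| = trans (sizeB≡sizeIn-not H A⁺)
    (trans (extend-scales (λ G A → sizeIn G (not ∘ A)) (λ G q A → sizeIn-□K G q (not ∘ A)) G ps A)
           (cong (_* product ps) (trans |B|≡a (sym |A|≡a))))

below : ∀ {n} → ℕ → Fin n → Bool
below p i = toℕ i <ᵇ p

module _ (p : ℕ) where

  sizeIn-below : sizeIn (K (2 * p)) (below p) ≡ p
  sizeIn-below = trans (∑-<ᵇ-allFin (2 * p) p) (m≥n⇒m⊓n≡n (m≤m+n p (p + 0)))

  sizeIn-not-below : sizeIn (K (2 * p)) (not ∘ below p) ≡ p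
  sizeIn-not-below = trans (+-cancelˡ-≡ p _ _ (begin
    p + sizeIn (K (2 * p)) (not ∘ below p)                               ≡⟨ cong (_+ sizeIn (K (2 * p)) (not ∘ below p)) (sym sizeIn-below) ⟩
    sizeIn (K (2 * p)) (below p) + sizeIn (K (2 * p)) (not ∘ below p)    ≡⟨ sizeIn+sizeIn-not (K (2 * p)) (below p) ⟩
    length (verts (K (2 * p)))                                           ≡⟨ length-verts-K (2 * p) ⟩
    p + (p + 0)                                                          ∎)) (+-identityʳ p)
    where open ≡-Reasoning

  crossEdges-below : crossEdges (K (2 * p)) (below p) ≡ p * p
  crossEdges-below =
    trans (crossEdges-K (2 * p) (below p))
          (trans (crossPairs≡sizeIn*sizeIn-not (K (2 * p)) (below p)) (cong₂ _*_ sizeIn-below sizeIn-not-below))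

congestion-boxKs-K : ∀ k ps → All (k ≤_) ps → Congestion (boxKs (K k) ps) (product ps)
congestion-boxKs-K k ps k≤ps =
  subst (Congestion (boxKs (K k) ps)) (*-identityˡ (product ps))
    (congestion-boxKs (K k) ps k≤ps (congestion-K k) (≤-reflexive (trans (length-verts-K k) (sym (*-identityʳ k)))))

length-verts-boxKs-K2 : ∀ p ps → length (verts (boxKs (K (2 * p)) ps)) ≡ p * product ps + p * product ps
length-verts-boxKs-K2 p ps = begin
  length (verts (boxKs (K (2 * p)) ps))     ≡⟨ length-verts-boxKs (K (2 * p)) ps ⟩
  length (verts (K (2 * p))) * product ps   ≡⟨ cong (_* product ps) (length-verts-K (2 * p)) ⟩
  (p + (p + 0)) * product ps                ≡⟨ cong (λ x → (p + x) * product ps) (+-identityʳ p) ⟩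
  (p + p) * product ps                      ≡⟨ *-distribʳ-+ (product ps) p p ⟩
  p * product ps + p * product ps           ∎
  where open ≡-Reasoning

bisection-boxKs-K2-≥ : ∀ p ps → All (1 ≤_) ps → All (2 * p ≤_) ps →
  ∀ A → Balanced (boxKs (K (2 * p)) ps) A → p * p * product ps ≤ cut (boxKs (K (2 * p)) ps) A
bisection-boxKs-K2-≥ p ps ps≥1 2p≤ps A balanced = *-cancelˡ-≤ P (begin
    P * (p * p * P)   ≡⟨ square-rearrange p P ⟩
    p * P * (p * P)   ≤⟨ congestion⇒bisection-≥ G {P} {p * P} (congestion-boxKs-K (2 * p) ps 2p≤ps)
                                                 (length-verts-boxKs-K2 p ps) A balanced ⟩
    P * cut G A       ∎)
  where
  open ≤-Reasoning
  P = product ps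
  G = boxKs (K (2 * p)) ps
  instance
    P≢0 : NonZero P
    P≢0 = product≢0 (All.map >-nonZero ps≥1)
  square-rearrange : ∀ p P → P * (p * p * P) ≡ p * P * (p * P)
  square-rearrange = solve-∀

corollary8p2 : (p₁ : ℕ) (ps : List ℕ) → 1 ≤ p₁ → All (1 ≤_) ps →
    Linked _≤_ (2 * p₁ ∷ ps) →
    BWis (boxKs (K (2 * p₁)) ps) (p₁ * p₁ * product ps)
corollary8p2 p ps _ ps≥1 sorted =
  (extend (K (2 * p)) ps (below p) ,
   extend-balanced-cut (K (2 * p)) ps (below p) (sizeIn-below p) (sizeIn-not-below p) (crossEdges-below p)) ,
  bisection-boxKs-K2-≥ p ps ps≥1 (AllPairs.head (Linked⇒AllPairs ≤-trans sorted))
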